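{- There exists an absolute constant $c$ such that for every integer $k\ge2$, $N^3_{2k+1}(m)\le c\,m\,\alpha_k(m)$ for all $m$.
   Context: An $\mathrm{ADS}^s_k(m)$-sequence is a sequence that is a concatenation of $m$ blocks, each block containing only distinct symbols, in which every symbol appears at least $k$ times, and which contains no (not necessarily contiguous) alternation $a\,b\,a\,b\ldots$ of length $s+2$ with $a\ne b$ (adjacent equal symbols at block interfaces are allowed). $N^s_k(m)$ is the maximum number of distinct symbols in an $\mathrm{ADS}^s_k(m)$-sequence. The inverse Ackermann hierarchy: $\alpha_1(x)=\lceil x/2\rceil$; for $k\ge2$, $\alpha_k(x)=0$ if $x\le1$ and $\alpha_k(x)=1+\alpha_k(\alpha_{k-1}(x))$ otherwise. -}

module Defs where

open import Data.Nat using (ℕ; zero; suc; _+_; _*_; _≤_; ⌈_/2⌉)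
open import Data.Nat.Properties using (_≟_)
open import Data.List using (List; []; _∷_; length; concat; filter; deduplicate)
open import Data.List.Relation.Unary.All using (All)
open import Data.List.Relation.Unary.Unique.Propositional using (Unique)
open import Data.List.Membership.Propositional using (_∈_)
open import Data.List.Relation.Binary.Sublist.Propositional using (_⊆_)
open import Relation.Binary.PropositionalEquality using (_≡_; _≢_)
open import Relation.Nullary using (¬_)

-- A sequence over the alphabet ℕ, presented as its list of blocks.
Blocks : Set
Blocks = List (List ℕ)

seq : Blocks → List ℕ
seq = concat

occ : ℕ → List ℕ → ℕ
occ x xs = length (filter (x ≟_) xs)

distinct : List ℕ → ℕ
distinct xs = length (deduplicate _≟_ xs)

alt : ℕ → ℕ → ℕ → List ℕ
alt a b zero    = []
alt a b (suc n) = a ∷ alt b a n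

record IsADS (s k m : ℕ) (bs : Blocks) : Set where
  field
    numBlocks   : length bs ≡ m
    blocksDistinct : All Unique bs
    enoughOcc   : ∀ x → x ∈ seq bs → k ≤ occ x (seq bs)
    noAlt       : ∀ a b → a ≢ b → ¬ (alt a b (s + 2) ⊆ seq bs)

-- iterate: number of applications of f needed to bring x down to ≤ 1,
-- computed with fuel (fuel = x suffices since α_{k-1}(x) < x for x ≥ 2).
iterCount : ℕ → (ℕ → ℕ) → ℕ → ℕ
iterCount zero       f x             = 0
iterCount (suc fuel) f zero          = 0
iterCount (suc fuel) f (suc zero)    = 0
iterCount (suc fuel) f (suc (suc x)) = 1 + iterCount fuel f (f (suc (suc x)))

-- inverse Ackermann hierarchy α_k (index 0 unused, set to 0)
α : ℕ → ℕ → ℕ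
α zero          x = 0
α (suc zero)    x = ⌈ x /2⌉
α (suc (suc k)) x = iterCount x (α (suc k)) x

module Submission where

open import Defs
open import Data.Nat using (ℕ; _+_; _*_; _≤_)
open import Data.Product using (∃-syntax)

-- The engine is a decomposition inequality. Cut the m blocks of an ADS³_{q+2}(m)
-- sequence into g groups of b consecutive blocks. Every symbol is
--   * local to one group: per group these form an ADS³_{q+2} sequence of ≤ b blocks;
--   * frequent, i.e. present in ≥ q groups: one copy per group visited gives an
--     ADS³_q(g) sequence (the contraction);
--   * or witnessed: some block is the middle of an occurrence pattern of the symbol
--     that, as a b a b a is forbidden, no other symbol shares; there are two kinds
--     of pattern, so at most 2m such symbols.
-- Hence N³_{q+2}(m) ≤ Σ_groups N³_{q+2}(group) + N³_q(g) + 2m.  For k = 2, two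
-- halves with an empty contraction give N³_5(m) ≤ 2m·α_2(m). For k ≥ 3, groups of
-- 8·α_{k-1}(m) blocks, decomposed twice, give the step from level k - 1 to level k.

open import Data.Nat
open import Data.Nat.Properties
open import Data.Nat.Induction using (<-rec)
open import Data.Nat.Tactic.RingSolver using (solve-∀)
open import Data.List using (List; []; _∷_; _++_; length; concat; filter; deduplicate; upTo)
open import Data.List.Properties using (filter-++; filter-accept; filter-reject; length-++; length-++-sucʳ; ++-assoc; ++-identityʳ; length-upTo)
open import Data.List.Relation.Unary.All using (All; []; _∷_; lookup)
open import Data.List.Relation.Unary.AllPairs using ([]; _∷_)
open import Data.List.Relation.Unary.Any using (here; there; tail)
open import Data.List.Relation.Unary.Unique.Propositional using (Unique)
open import Data.List.Relation.Unary.Unique.Propositional.Properties using (filter⁺)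
open import Data.List.Relation.Unary.Unique.DecPropositional.Properties _≟_ using (deduplicate-!)
open import Data.List.Membership.Propositional using (_∈_; _∉_)
open import Data.List.Membership.Propositional.Properties using (∈-∃++; ∈-++⁺ˡ; ∈-++⁺ʳ; ∈-++⁻; ∈-filter⁺; ∈-filter⁻; ∈-deduplicate⁺; ∈-deduplicate⁻; ∈-upTo⁺)
open import Data.List.Membership.DecPropositional _≟_ using (_∈?_)
open import Data.List.Relation.Binary.Sublist.Propositional using (_⊆_; []; _∷_; from∈; ⊆-refl; ⊆-trans)
open import Data.List.Relation.Binary.Sublist.Propositional.Properties using (++⁺; ++⁺ˡ; ++⁺ʳ; filter-⊆)
open import Data.Product using (Σ; ∃; _×_; _,_; proj₁; proj₂)
open import Data.Sum using (_⊎_; inj₁; inj₂)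
open import Data.Empty using (⊥; ⊥-elim)
open import Relation.Binary.PropositionalEquality
open import Relation.Binary.Definitions using (tri<; tri≈; tri>)
open import Relation.Nullary using (Dec; yes; no; ¬_; contradiction)
open import Relation.Nullary.Decidable using (_×-dec_)

-- A function is *shrinking* if it strictly decreases every argument ≥ 2.
-- Each α_k (k ≥ 1) is shrinking, which is what makes α_{k+1} = Iter α_k sensible.
record Shrinking (f : ℕ → ℕ) : Set where
  constructor shrinking
  field shrinks : ∀ y → f (2 + y) < 2 + y
open Shrinking

-- The number of times f must be applied to x to reach a value ≤ 1; with this
-- name α (2 + k) is definitionally Iter (α (1 + k)).
Iter : (ℕ → ℕ) → ℕ → ℕ
Iter f x = iterCount x f x

iterCount-fuel : ∀ {f} → Shrinking f →
                 ∀ F₁ F₂ x → x ≤ F₁ → x ≤ F₂ → iterCount F₁ f x ≡ iterCount F₂ f x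
iterCount-fuel sh zero zero zero _ _ = refl
iterCount-fuel sh zero (suc F₂) zero _ _ = refl
iterCount-fuel sh (suc F₁) zero zero _ _ = refl
iterCount-fuel sh (suc F₁) (suc F₂) zero _ _ = refl
iterCount-fuel sh (suc F₁) (suc F₂) (suc zero) _ _ = refl
iterCount-fuel {f} sh (suc F₁) (suc F₂) (suc (suc y)) le₁ le₂ =
  cong suc (iterCount-fuel sh F₁ F₂ (f (2 + y))
             (≤-pred (≤-trans (shrinks sh y) le₁)) (≤-pred (≤-trans (shrinks sh y) le₂)))

Iter-unfold : ∀ {f} → Shrinking f → ∀ y → Iter f (2 + y) ≡ 1 + Iter f (f (2 + y))
Iter-unfold {f} sh y =
  cong suc (iterCount-fuel sh (suc y) (f (2 + y)) (f (2 + y)) (≤-pred (shrinks sh y)) ≤-refl)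

Iter-pos : ∀ {f} → Shrinking f → ∀ y → 1 ≤ Iter f (2 + y)
Iter-pos sh y = subst (1 ≤_) (sym (Iter-unfold sh y)) (s≤s z≤n)

Iter-shrinking : ∀ {f} → Shrinking f → Shrinking (Iter f)
Iter-shrinking {f} sh = shrinking (<-rec _ step)
  where
  step : ∀ y → (∀ {z} → z < y → Iter f (2 + z) < 2 + z) → Iter f (2 + y) < 2 + y
  step y rec = subst (_< 2 + y) (sym (Iter-unfold sh y)) (below (f (2 + y)) (shrinks sh y))
    where
    below : ∀ w → w < 2 + y → 1 + Iter f w < 2 + y
    below zero          _  = s≤s (s≤s z≤n)
    below (suc zero)    _  = s≤s (s≤s z≤n)
    below (suc (suc z)) lt = ≤-trans (s≤s (rec (≤-pred (≤-pred lt)))) lt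

Iter-mono : ∀ {f} → Shrinking f → (∀ {x y} → x ≤ y → f x ≤ f y) →
            ∀ {x y} → x ≤ y → Iter f x ≤ Iter f y
Iter-mono {f} sh mono {x} {y} = <-rec P step y x
  where
  P : ℕ → Set
  P y = ∀ x → x ≤ y → Iter f x ≤ Iter f y
  step : ∀ y → (∀ {z} → z < y → P z) → P y
  step _ rec zero _ = z≤n
  step _ rec (suc zero) _ = z≤n
  step zero rec (suc (suc x)) ()
  step (suc zero) rec (suc (suc x)) (s≤s ())
  step (suc (suc y)) rec (suc (suc x)) le = begin
    Iter f (2 + x)           ≡⟨ Iter-unfold sh x ⟩
    1 + Iter f (f (2 + x))   ≤⟨ s≤s (rec (shrinks sh y) _ (mono le)) ⟩
    1 + Iter f (f (2 + y))   ≡⟨ Iter-unfold sh y ⟨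
    Iter f (2 + y)           ∎
    where open ≤-Reasoning

Iter-≤ : ∀ {f} → Shrinking f → (∀ y → 1 ≤ f (2 + y)) → ∀ x → Iter f x ≤ f x
Iter-≤ sh pos zero = z≤n
Iter-≤ sh pos (suc zero) = z≤n
Iter-≤ {f} sh pos (suc (suc y)) =
  subst (_≤ f (2 + y)) (sym (Iter-unfold sh y)) (below (f (2 + y)) (pos y))
  where
  below : ∀ z → 1 ≤ z → 1 + Iter f z ≤ z
  below (suc zero) _ = ≤-refl
  below (suc (suc z)) _ = shrinks (Iter-shrinking sh) z

α-shrinking : ∀ k → Shrinking (α (suc k))
α-shrinking zero = shrinking ⌈n/2⌉<n
α-shrinking (suc k) = Iter-shrinking (α-shrinking k)

α-unfold : ∀ k y → α (2 + k) (2 + y) ≡ 1 + α (2 + k) (α (1 + k) (2 + y))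
α-unfold k = Iter-unfold (α-shrinking k)

α-pos : ∀ k y → 1 ≤ α (suc k) (2 + y)
α-pos zero y = s≤s z≤n
α-pos (suc k) = Iter-pos (α-shrinking k)

α-mono : ∀ k {x y} → x ≤ y → α (suc k) x ≤ α (suc k) y
α-mono zero = ⌈n/2⌉-mono
α-mono (suc k) = Iter-mono (α-shrinking k) (α-mono k)

α≤α₂ : ∀ k x → α (2 + k) x ≤ α 2 x
α≤α₂ zero x = ≤-refl
α≤α₂ (suc k) x = ≤-trans (Iter-≤ (α-shrinking (suc k)) (α-pos (suc k)) x) (α≤α₂ k x)

α₂-double : ∀ n → 1 ≤ n → α 2 (2 * n) ≡ 1 + α 2 n
α₂-double (suc n) _ = begin
  α 2 (2 * suc n)                  ≡⟨ cong (α 2) (double n) ⟩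
  α 2 (2 + (n + n))                ≡⟨ α-unfold 0 (n + n) ⟩
  1 + α 2 ⌈ 2 + (n + n) /2⌉         ≡⟨ cong (λ w → 1 + α 2 w) half ⟩
  1 + α 2 (suc n)                  ∎
  where
  open ≡-Reasoning
  half : ⌈ 2 + (n + n) /2⌉ ≡ suc n
  half = sym (trans (n≡⌈n+n/2⌉ (suc n)) (cong ⌈_/2⌉ (cong suc (+-suc n n))))
  double : ∀ n → 2 * suc n ≡ 2 + (n + n)
  double = solve-∀

α₂-×8 : ∀ n → 1 ≤ n → α 2 (8 * n) ≡ 3 + α 2 n
α₂-×8 n p = begin
  α 2 (8 * n)               ≡⟨ cong (α 2) (eight n) ⟩
  α 2 (2 * (2 * (2 * n)))   ≡⟨ α₂-double (2 * (2 * n)) (≤-trans p₂ (m≤n*m (2 * n) 2)) ⟩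
  1 + α 2 (2 * (2 * n))     ≡⟨ cong suc (α₂-double (2 * n) p₂) ⟩
  2 + α 2 (2 * n)           ≡⟨ cong (2 +_) (α₂-double n p) ⟩
  3 + α 2 n                 ∎
  where
  open ≡-Reasoning
  p₂ : 1 ≤ 2 * n
  p₂ = ≤-trans p (m≤n*m n 2)
  eight : ∀ n → 8 * n ≡ 2 * (2 * (2 * n))
  eight = solve-∀

α₂-linear : ∀ x → 16 * α 2 x ≤ x + 128
α₂-linear = <-rec _ step
  where
  step : ∀ x → (∀ {z} → z < x → 16 * α 2 z ≤ z + 128) → 16 * α 2 x ≤ x + 128
  step x rec with x ≤? 34
  ... | yes small =   -- 16 * α 2 34 = 96 ≤ 128
    ≤-trans (*-monoʳ-≤ 16 (α-mono 1 small)) (≤-trans (m≤m+n 96 32) (m≤n+m 128 x))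
  step (suc (suc y)) rec | no big = begin
    16 * α 2 (2 + y)            ≡⟨ cong (16 *_) (α-unfold 0 y) ⟩
    16 * (1 + α 2 h)            ≡⟨ *-distribˡ-+ 16 1 (α 2 h) ⟩
    16 + 16 * α 2 h             ≤⟨ +-monoʳ-≤ 16 (rec (shrinks (α-shrinking 0) y)) ⟩
    16 + (h + 128)              ≡⟨ sym (+-assoc 16 h 128) ⟩
    16 + h + 128                ≤⟨ +-monoˡ-≤ 128 half-room ⟩
    2 + y + 128                 ∎
    where
    open ≤-Reasoning
    h = ⌈ 2 + y /2⌉
    half-room : 16 + h ≤ 2 + y
    half-room = begin
      16 + h                    ≤⟨ +-monoˡ-≤ h (⌊n/2⌋-mono (≤-trans (m≤m+n 32 3) (≰⇒> big))) ⟩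
      ⌊ 2 + y /2⌋ + h           ≡⟨ ⌊n/2⌋+⌈n/2⌉≡n (2 + y) ⟩
      2 + y                     ∎
  step zero          rec | no big = contradiction z≤n big
  step (suc zero)    rec | no big = contradiction (s≤s z≤n) big

-- The numerical fact behind the block size 8·α_{k-1}(m) of the induction step:
-- for T ≥ 176, eight times α_2(8T) is at most T.
α₂-key : ∀ T → 176 ≤ T → 8 * α 2 (8 * T) ≤ T
α₂-key T 176≤T = *-cancelˡ-≤ 2 (begin
  2 * (8 * α 2 (8 * T))   ≡⟨ cong (λ w → 2 * (8 * w)) (α₂-×8 T (≤-trans (s≤s z≤n) 176≤T)) ⟩
  2 * (8 * (3 + α 2 T))   ≡⟨ expand (α 2 T) ⟩
  48 + 16 * α 2 T         ≤⟨ +-monoʳ-≤ 48 (α₂-linear T) ⟩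
  48 + (T + 128)          ≡⟨ regroup T ⟩
  176 + T                 ≤⟨ +-monoˡ-≤ T 176≤T ⟩
  T + T                   ≡⟨ cong (T +_) (+-identityʳ T) ⟨
  2 * T                   ∎)
  where
  open ≤-Reasoning
  expand : ∀ a → 2 * (8 * (3 + a)) ≡ 48 + 16 * a
  expand = solve-∀
  regroup : ∀ t → 48 + (t + 128) ≡ 176 + t
  regroup = solve-∀

α₂-1400 : α 2 1400 ≡ 11
α₂-1400 = refl

occ-++ : ∀ x xs ys → occ x (xs ++ ys) ≡ occ x xs + occ x ys
occ-++ x xs ys = trans (cong length (filter-++ (x ≟_) xs ys)) (length-++ (filter (x ≟_) xs))

occ-self : ∀ x xs → occ x (x ∷ xs) ≡ suc (occ x xs)
occ-self x xs = cong length (filter-accept (x ≟_) {x} {xs} refl)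

occ-other : ∀ {x y} xs → x ≢ y → occ x (y ∷ xs) ≡ occ x xs
occ-other {x} {y} xs x≢y = cong length (filter-reject (x ≟_) {y} {xs} x≢y)

occ-∷ : ∀ x y xs → (x ≡ y × occ x (y ∷ xs) ≡ suc (occ x xs)) ⊎ (x ≢ y × occ x (y ∷ xs) ≡ occ x xs)
occ-∷ x y xs with x ≟ y
... | yes refl = inj₁ (refl , occ-self x xs)
... | no x≢y = inj₂ (x≢y , occ-other xs x≢y)

∈⇒occ>0 : ∀ {x xs} → x ∈ xs → 1 ≤ occ x xs
∈⇒occ>0 {x} {y ∷ xs} x∈ with occ-∷ x y xs
... | inj₁ (_ , eq) = subst (1 ≤_) (sym eq) (s≤s z≤n)
... | inj₂ (x≢y , eq) = subst (1 ≤_) (sym eq) (∈⇒occ>0 (tail x≢y x∈))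

occ>0⇒∈ : ∀ {x} xs → 1 ≤ occ x xs → x ∈ xs
occ>0⇒∈ {x} (y ∷ xs) p with occ-∷ x y xs
... | inj₁ (refl , _) = here refl
... | inj₂ (_ , eq) = there (occ>0⇒∈ xs (subst (1 ≤_) eq p))

∉⇒occ≡0 : ∀ {x} xs → x ∉ xs → occ x xs ≡ 0
∉⇒occ≡0 [] _ = refl
∉⇒occ≡0 {x} (y ∷ xs) x∉ with occ-∷ x y xs
... | inj₁ (refl , _) = contradiction (here refl) x∉
... | inj₂ (_ , eq) = trans eq (∉⇒occ≡0 xs (λ x∈ → x∉ (there x∈)))

occ-unique : ∀ {x} xs → Unique xs → occ x xs ≤ 1
occ-unique [] _ = z≤n
occ-unique {x} (y ∷ xs) (y∉xs ∷ u) with occ-∷ x y xs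
... | inj₁ (refl , eq) = ≤-reflexive (trans eq (cong suc (∉⇒occ≡0 xs (λ x∈ → lookup y∉xs x∈ refl))))
... | inj₂ (_ , eq) = ≤-trans (≤-reflexive eq) (occ-unique xs u)

occ-filter : ∀ {P : ℕ → Set} (P? : ∀ z → Dec (P z)) {x} → P x → ∀ xs →
             occ x (filter P? xs) ≡ occ x xs
occ-filter P? px [] = refl
occ-filter P? {x} px (y ∷ xs) with P? y | occ-∷ x y xs
... | yes py | inj₁ (refl , eq) = trans (occ-self x _) (trans (cong suc (occ-filter P? px xs)) (sym eq))
... | yes py | inj₂ (x≢y , eq) = trans (occ-other _ x≢y) (trans (occ-filter P? px xs) (sym eq))
... | no ¬py | inj₁ (refl , _) = contradiction px ¬py
... | no ¬py | inj₂ (_ , eq) = trans (occ-filter P? px xs) (sym eq)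

occ-dedup : ∀ {x} xs → x ∈ xs → occ x (deduplicate _≟_ xs) ≡ 1
occ-dedup xs x∈ =
  ≤-antisym (occ-unique _ (deduplicate-! xs)) (∈⇒occ>0 (∈-deduplicate⁺ _≟_ x∈))

occ-dedup-∉ : ∀ {x} xs → x ∉ xs → occ x (deduplicate _≟_ xs) ≡ 0
occ-dedup-∉ xs x∉ = ∉⇒occ≡0 _ (λ x∈ → x∉ (∈-deduplicate⁻ _≟_ xs x∈))

deduplicate-⊆ : ∀ xs → deduplicate _≟_ xs ⊆ xs
deduplicate-⊆ [] = []
deduplicate-⊆ (x ∷ xs) = refl ∷ ⊆-trans (filter-⊆ _ (deduplicate _≟_ xs)) (deduplicate-⊆ xs)

∈-remove : ∀ {x y : ℕ} ys {zs} → x ∈ ys ++ y ∷ zs → x ≢ y → x ∈ ys ++ zs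
∈-remove ys x∈ x≢y with ∈-++⁻ ys x∈
... | inj₁ p = ∈-++⁺ˡ p
... | inj₂ (here refl) = contradiction refl x≢y
... | inj₂ (there p) = ∈-++⁺ʳ ys p

pigeonhole : ∀ (f : ℕ → ℕ) xs ys → Unique xs →
             (∀ {a b} → a ∈ xs → b ∈ xs → f a ≡ f b → a ≡ b) →
             (∀ {a} → a ∈ xs → f a ∈ ys) → length xs ≤ length ys
pigeonhole f [] ys _ _ _ = z≤n
pigeonhole f (x ∷ xs) ys (x∉xs ∷ u) inj into with ∈-∃++ (into (here refl))
... | ys₁ , ys₂ , refl = begin
  suc (length xs)               ≤⟨ s≤s (pigeonhole f xs (ys₁ ++ ys₂) u inj′ into′) ⟩
  suc (length (ys₁ ++ ys₂))     ≡⟨ length-++-sucʳ ys₁ (f x) ys₂ ⟨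
  length (ys₁ ++ f x ∷ ys₂)     ∎
  where
  open ≤-Reasoning
  inj′ : ∀ {a b} → a ∈ xs → b ∈ xs → f a ≡ f b → a ≡ b
  inj′ a∈ b∈ = inj (there a∈) (there b∈)
  into′ : ∀ {a} → a ∈ xs → f a ∈ ys₁ ++ ys₂
  into′ a∈ = ∈-remove ys₁ (into (there a∈))
    (λ fa≡fx → lookup x∉xs a∈ (inj (here refl) (there a∈) (sym fa≡fx)))

-- Alternations. A sequence is 5-alternation-free when no a b a b a with a ≢ b
-- occurs in it as a subsequence (this is the condition s = 3 of an ADS).

AltFree5 : List ℕ → Set
AltFree5 s = ∀ a b → a ≢ b → ¬ (alt a b 5 ⊆ s)

Shared : ℕ → ℕ → List ℕ → Set
Shared x y S = x ∈ S × y ∈ S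

split-between : ∀ {x y : ℕ} W → x ∈ W → y ∈ W → x ≢ y →
  (Σ (List ℕ) λ W₁ → Σ (List ℕ) λ W₂ → W ≡ W₁ ++ W₂ × x ∈ W₁ × y ∈ W₂) ⊎
  (Σ (List ℕ) λ W₁ → Σ (List ℕ) λ W₂ → W ≡ W₁ ++ W₂ × y ∈ W₁ × x ∈ W₂)
split-between (w ∷ W) (here refl) (here refl) x≢y = contradiction refl x≢y
split-between (w ∷ W) (here refl) (there y∈) _ = inj₁ (w ∷ [] , W , refl , here refl , y∈)
split-between (w ∷ W) (there x∈) (here refl) _ = inj₂ (w ∷ [] , W , refl , here refl , x∈)
split-between (w ∷ W) (there x∈) (there y∈) x≢y with split-between W x∈ y∈ x≢y
... | inj₁ (W₁ , W₂ , refl , p , q) = inj₁ (w ∷ W₁ , W₂ , refl , there p , q)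
... | inj₂ (W₁ , W₂ , refl , p , q) = inj₂ (w ∷ W₁ , W₂ , refl , there p , q)

alt-from-segments : ∀ {x y : ℕ} S₁ W₁ W₂ S₃ S₄ →
  y ∈ S₁ → x ∈ W₁ → y ∈ W₂ → x ∈ S₃ → y ∈ S₄ → alt y x 5 ⊆ S₁ ++ (W₁ ++ W₂) ++ S₃ ++ S₄
alt-from-segments S₁ W₁ W₂ S₃ S₄ p₁ p₂ p₃ p₄ p₅ rewrite ++-assoc W₁ W₂ (S₃ ++ S₄) =
  ++⁺ (from∈ p₁) (++⁺ (from∈ p₂) (++⁺ (from∈ p₃) (++⁺ (from∈ p₄) (from∈ p₅))))

-- Two symbols both occurring in each of four consecutive segments of a
-- 5-alternation-free sequence are equal: whichever of them comes first inside
-- the second segment, the other three segments complete an alternation of length 5.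
four-segments : ∀ {s} → AltFree5 s → ∀ {x y} S₁ S₂ S₃ S₄ → S₁ ++ S₂ ++ S₃ ++ S₄ ⊆ s →
                Shared x y S₁ → Shared x y S₂ → Shared x y S₃ → Shared x y S₄ → x ≡ y
four-segments free {x} {y} S₁ S₂ S₃ S₄ sub (x₁ , y₁) (x₂ , y₂) (x₃ , y₃) (x₄ , y₄) with x ≟ y
... | yes x≡y = x≡y
... | no x≢y with split-between S₂ x₂ y₂ x≢y
...   | inj₁ (W₁ , W₂ , refl , p , q) =
  contradiction (⊆-trans (alt-from-segments S₁ W₁ W₂ S₃ S₄ y₁ p q x₃ y₄) sub) (free y x (≢-sym x≢y))
...   | inj₂ (W₁ , W₂ , refl , p , q) =
  contradiction (⊆-trans (alt-from-segments S₁ W₁ W₂ S₃ S₄ x₁ p q y₃ x₄) sub) (free x y x≢y)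

-- Consecutive blocks. block bs p is the p-th block (empty beyond the end) and
-- range bs lo n the concatenation of the n blocks starting at index lo.

block : Blocks → ℕ → List ℕ
block [] p = []
block (B ∷ bs) zero = B
block (B ∷ bs) (suc p) = block bs p

range : Blocks → ℕ → ℕ → List ℕ
range bs lo zero = []
range bs lo (suc n) = block bs lo ++ range bs (suc lo) n

range-tail : ∀ B bs lo n → range (B ∷ bs) (suc lo) n ≡ range bs lo n
range-tail B bs lo zero = refl
range-tail B bs lo (suc n) = cong (block bs lo ++_) (range-tail B bs (suc lo) n)

range-+ : ∀ bs lo n₁ n₂ → range bs lo (n₁ + n₂) ≡ range bs lo n₁ ++ range bs (lo + n₁) n₂
range-+ bs lo zero n₂ rewrite +-identityʳ lo = refl
range-+ bs lo (suc n₁) n₂ rewrite range-+ bs (suc lo) n₁ n₂ | +-suc lo n₁ =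
  sym (++-assoc (block bs lo) (range bs (suc lo) n₁) _)

block-beyond : ∀ bs p → length bs ≤ p → block bs p ≡ []
block-beyond [] p _ = refl
block-beyond (B ∷ bs) (suc p) (s≤s le) = block-beyond bs p le

range-beyond : ∀ bs lo n → length bs ≤ lo → range bs lo n ≡ []
range-beyond bs lo zero _ = refl
range-beyond bs lo (suc n) le rewrite block-beyond bs lo le = range-beyond bs (suc lo) n (m≤n⇒m≤1+n le)

range-whole : ∀ bs → range bs 0 (length bs) ≡ concat bs
range-whole [] = refl
range-whole (B ∷ bs) = cong (B ++_) (trans (range-tail B bs 0 (length bs)) (range-whole bs))

range-all : ∀ bs N → length bs ≤ N → range bs 0 N ≡ concat bs
range-all bs N le = begin
  range bs 0 N                                                      ≡⟨ cong (range bs 0) (m+[n∸m]≡n le) ⟨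
  range bs 0 (length bs + (N ∸ length bs))                          ≡⟨ range-+ bs 0 (length bs) _ ⟩
  range bs 0 (length bs) ++ range bs (length bs) (N ∸ length bs)    ≡⟨ cong₂ _++_ (range-whole bs) (range-beyond bs (length bs) (N ∸ length bs) ≤-refl) ⟩
  concat bs ++ []                                                   ≡⟨ ++-identityʳ _ ⟩
  concat bs                                                         ∎
  where open ≡-Reasoning

range-⊆ : ∀ bs lo n → range bs lo n ⊆ concat bs
range-⊆ bs lo n = subst (range bs lo n ⊆_) split (++⁺ˡ (range bs 0 lo) (++⁺ʳ (range bs (lo + n) (length bs)) ⊆-refl))
  where
  open ≡-Reasoning
  split : range bs 0 lo ++ range bs lo n ++ range bs (lo + n) (length bs) ≡ concat bs
  split = begin
    range bs 0 lo ++ range bs lo n ++ range bs (lo + n) (length bs)  ≡⟨ cong (range bs 0 lo ++_) (range-+ bs lo n _) ⟨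
    range bs 0 lo ++ range bs lo (n + length bs)                     ≡⟨ range-+ bs 0 lo _ ⟨
    range bs 0 (lo + (n + length bs))                                ≡⟨ range-all bs _ (≤-trans (m≤n+m (length bs) n) (m≤n+m _ lo)) ⟩
    concat bs                                                        ∎

block-index : ∀ bs p {x} → x ∈ block bs p → p < length bs
block-index [] p ()
block-index (B ∷ bs) zero _ = s≤s z≤n
block-index (B ∷ bs) (suc p) x∈ = s≤s (block-index bs p x∈)

block-unique : ∀ bs p → All Unique bs → Unique (block bs p)
block-unique [] p _ = []
block-unique (B ∷ bs) zero (u ∷ _) = u
block-unique (B ∷ bs) (suc p) (_ ∷ us) = block-unique bs p us

tabulateFrom : ∀ {A : Set} → (ℕ → A) → ℕ → ℕ → List A
tabulateFrom f i zero = []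
tabulateFrom f i (suc n) = f i ∷ tabulateFrom f (suc i) n

sumFrom : (ℕ → ℕ) → ℕ → ℕ → ℕ
sumFrom f i zero = 0
sumFrom f i (suc n) = f i + sumFrom f (suc i) n

length-tabulateFrom : ∀ {A : Set} (f : ℕ → A) i n → length (tabulateFrom f i n) ≡ n
length-tabulateFrom f i zero = refl
length-tabulateFrom f i (suc n) = cong suc (length-tabulateFrom f (suc i) n)

All-tabulateFrom : ∀ {P : List ℕ → Set} (f : ℕ → List ℕ) i n → (∀ k → P (f k)) → All P (tabulateFrom f i n)
All-tabulateFrom f i zero _ = []
All-tabulateFrom f i (suc n) p = p i ∷ All-tabulateFrom f (suc i) n p

length-concat-tab : ∀ (f : ℕ → List ℕ) i n → length (concat (tabulateFrom f i n)) ≡ sumFrom (λ k → length (f k)) i n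
length-concat-tab f i zero = refl
length-concat-tab f i (suc n) = trans (length-++ (f i)) (cong (length (f i) +_) (length-concat-tab f (suc i) n))

occ-concat-tab : ∀ x (f : ℕ → List ℕ) i n → occ x (concat (tabulateFrom f i n)) ≡ sumFrom (λ k → occ x (f k)) i n
occ-concat-tab x f i zero = refl
occ-concat-tab x f i (suc n) = trans (occ-++ x (f i) _) (cong (occ x (f i) +_) (occ-concat-tab x f (suc i) n))

∈-concat-tab : ∀ {z} (f : ℕ → List ℕ) i n k → i ≤ k → k < i + n → z ∈ f k → z ∈ concat (tabulateFrom f i n)
∈-concat-tab f i zero k i≤k k<i rewrite +-identityʳ i = contradiction i≤k (<⇒≱ k<i)
∈-concat-tab f i (suc n) k i≤k k< z∈ with i ≟ k
... | yes refl = ∈-++⁺ˡ z∈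
... | no i≢k = ∈-++⁺ʳ (f i) (∈-concat-tab f (suc i) n k (≤∧≢⇒< i≤k i≢k) (subst (k <_) (+-suc i n) k<) z∈)

concat-tab-∈ : ∀ {z} (f : ℕ → List ℕ) i n → z ∈ concat (tabulateFrom f i n) → Σ ℕ λ k → i ≤ k × k < i + n × z ∈ f k
concat-tab-∈ f i zero ()
concat-tab-∈ f i (suc n) z∈ with ∈-++⁻ (f i) z∈
... | inj₁ p = i , ≤-refl , m<m+n i (s≤s z≤n) , p
... | inj₂ p with concat-tab-∈ f (suc i) n p
...   | k , i<k , k< , q = k , <⇒≤ i<k , subst (k <_) (sym (+-suc i n)) k< , q

concat-tab-⊆ : ∀ (f h : ℕ → List ℕ) i n → (∀ k → f k ⊆ h k) → concat (tabulateFrom f i n) ⊆ concat (tabulateFrom h i n)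
concat-tab-⊆ f h i zero _ = []
concat-tab-⊆ f h i (suc n) p = ++⁺ (p i) (concat-tab-⊆ f h (suc i) n p)

concat-groups : ∀ bs b i n → concat (tabulateFrom (λ k → range bs (k * b) b) i n) ≡ range bs (i * b) (n * b)
concat-groups bs b i zero = refl
concat-groups bs b i (suc n) = begin
  range bs (i * b) b ++ concat (tabulateFrom (λ k → range bs (k * b) b) (suc i) n) ≡⟨ cong (range bs (i * b) b ++_) (concat-groups bs b (suc i) n) ⟩
  range bs (i * b) b ++ range bs (b + i * b) (n * b)                              ≡⟨ cong (λ w → range bs (i * b) b ++ range bs w (n * b)) (+-comm b (i * b)) ⟩
  range bs (i * b) b ++ range bs (i * b + b) (n * b)                              ≡⟨ range-+ bs (i * b) b (n * b) ⟨
  range bs (i * b) (b + n * b)                                                    ∎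
  where open ≡-Reasoning

concat-filter-blocks : ∀ {P : ℕ → Set} (P? : ∀ z → Dec (P z)) bs lo n →
  concat (tabulateFrom (λ p → filter P? (block bs p)) lo n) ≡ filter P? (range bs lo n)
concat-filter-blocks P? bs lo zero = refl
concat-filter-blocks P? bs lo (suc n) =
  trans (cong (filter P? (block bs lo) ++_) (concat-filter-blocks P? bs (suc lo) n)) (sym (filter-++ P? (block bs lo) _))

sumFrom-mono : ∀ (f h : ℕ → ℕ) i n → (∀ k → f k ≤ h k) → sumFrom f i n ≤ sumFrom h i n
sumFrom-mono f h i zero _ = z≤n
sumFrom-mono f h i (suc n) le = +-mono-≤ (le i) (sumFrom-mono f h (suc i) n le)

sumFrom-*ʳ : ∀ (f : ℕ → ℕ) c i n → sumFrom (λ k → f k * c) i n ≡ sumFrom f i n * c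
sumFrom-*ʳ f c i zero = refl
sumFrom-*ʳ f c i (suc n) = trans (cong (f i * c +_) (sumFrom-*ʳ f c (suc i) n)) (sym (*-distribʳ-+ c (f i) _))

sumFrom-shift : ∀ (f : ℕ → ℕ) i n → sumFrom f (suc i) n ≡ sumFrom (λ k → f (suc k)) i n
sumFrom-shift f i zero = refl
sumFrom-shift f i (suc n) = cong (f (suc i) +_) (sumFrom-shift f (suc i) n)

sumFrom-cong : ∀ (f h : ℕ → ℕ) i n → (∀ k → f k ≡ h k) → sumFrom f i n ≡ sumFrom h i n
sumFrom-cong f h i zero _ = refl
sumFrom-cong f h i (suc n) eq = cong₂ _+_ (eq i) (sumFrom-cong f h (suc i) n eq)

group-sizes : ∀ b g M → sumFrom (λ i → b ⊓ (M ∸ i * b)) 0 g ≡ M ⊓ (g * b)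
group-sizes b zero M = sym (⊓-zeroʳ M)
group-sizes b (suc g) M = begin
  b ⊓ M + sumFrom (λ i → b ⊓ (M ∸ i * b)) 1 g        ≡⟨ cong (b ⊓ M +_) (sumFrom-shift _ 0 g) ⟩
  b ⊓ M + sumFrom (λ i → b ⊓ (M ∸ (b + i * b))) 0 g  ≡⟨ cong (b ⊓ M +_) (sumFrom-cong _ _ 0 g (λ k → cong (b ⊓_) (sym (∸-+-assoc M b (k * b))))) ⟩
  b ⊓ M + sumFrom (λ i → b ⊓ ((M ∸ b) ∸ i * b)) 0 g  ≡⟨ cong (b ⊓ M +_) (group-sizes b g (M ∸ b)) ⟩
  b ⊓ M + (M ∸ b) ⊓ (g * b)                         ≡⟨ first-group (M ≤? b) ⟩
  M ⊓ (b + g * b)                                   ∎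
  where
  open ≡-Reasoning
  first-group : Dec (M ≤ b) → b ⊓ M + (M ∸ b) ⊓ (g * b) ≡ M ⊓ (b + g * b)
  first-group (yes M≤b) rewrite m≥n⇒m⊓n≡n M≤b | m≤n⇒m∸n≡0 M≤b =
    trans (+-identityʳ M) (sym (m≤n⇒m⊓n≡m (≤-trans M≤b (m≤m+n b _))))
  first-group (no M≰b) rewrite m≤n⇒m⊓n≡m (<⇒≤ (≰⇒> M≰b)) =
    trans (+-distribˡ-⊓ b (M ∸ b) (g * b)) (cong (_⊓ (b + g * b)) (m+[n∸m]≡n (<⇒≤ (≰⇒> M≰b))))

group-order : ∀ b i i′ o o′ → o < b → i < i′ → i * b + o < i′ * b + o′
group-order b i i′ o o′ o< i<i′ = begin-strict
  i * b + o     <⟨ +-monoʳ-< (i * b) o< ⟩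
  i * b + b     ≡⟨ +-comm (i * b) b ⟩
  suc i * b     ≤⟨ *-monoˡ-≤ b i<i′ ⟩
  i′ * b        ≤⟨ m≤m+n _ o′ ⟩
  i′ * b + o′   ∎
  where open ≤-Reasoning

position-injective : ∀ b i i′ o o′ → o < b → o′ < b → i * b + o ≡ i′ * b + o′ → i ≡ i′ × o ≡ o′
position-injective b i i′ o o′ o< o′< eq with <-cmp i i′
... | tri≈ _ refl _ = refl , +-cancelˡ-≡ (i * b) o o′ eq
... | tri< i<i′ _ _ = contradiction eq (<⇒≢ (group-order b i i′ o o′ o< i<i′))
... | tri> _ _ i′<i = contradiction (sym eq) (<⇒≢ (group-order b i′ i o′ o o′< i′<i))

weaken : ∀ {s k k′ m bs} → k′ ≤ k → IsADS s k m bs → IsADS s k′ m bs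
weaken k′≤k A = record
  { numBlocks = IsADS.numBlocks A
  ; blocksDistinct = IsADS.blocksDistinct A
  ; enoughOcc = λ x x∈ → ≤-trans k′≤k (IsADS.enoughOcc A x x∈)
  ; noAlt = IsADS.noAlt A }

occ≤blocks : ∀ x bs → All Unique bs → occ x (concat bs) ≤ length bs
occ≤blocks x [] _ = z≤n
occ≤blocks x (B ∷ bs) (u ∷ us) = ≤-trans (≤-reflexive (occ-++ x B (concat bs))) (+-mono-≤ (occ-unique B u) (occ≤blocks x bs us))

-- With fewer than k blocks no symbol can occur k times, so there are no symbols.
few-blocks : ∀ {s k m bs} → IsADS s k m bs → m < k → ∀ {n} → distinct (seq bs) ≤ n
few-blocks {k = k} {m} {bs} A m<k with seq bs in eq
... | [] = z≤n
... | x ∷ _ = contradiction k≤m (<⇒≱ m<k)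
  where
  x∈ : x ∈ seq bs
  x∈ = subst (x ∈_) (sym eq) (here refl)
  k≤m : k ≤ m
  k≤m = ≤-trans (IsADS.enoughOcc A x x∈)
          (≤-trans (occ≤blocks x bs (IsADS.blocksDistinct A)) (≤-reflexive (IsADS.numBlocks A)))

-- N³≤ q m N: every ADS³_q(m)-sequence has at most N distinct symbols, i.e. N³_q(m) ≤ N.
N³≤ : ℕ → ℕ → ℕ → Set
N³≤ q m N = ∀ bs → IsADS 3 q m bs → distinct (seq bs) ≤ N

N³≤-mono : ∀ {q m N N′} → N ≤ N′ → N³≤ q m N → N³≤ q m N′
N³≤-mono N≤N′ bound bs A = ≤-trans (bound bs A) N≤N′

offset-+ : ∀ lo o t n → o + 1 + t ≡ n → lo + o + 1 + t ≡ lo + n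
offset-+ lo o t n split = trans (+-assoc (lo + o) 1 t) (trans (+-assoc lo o (1 + t)) (cong (lo +_) (trans (sym (+-assoc o 1 t)) split)))

offset-rest : ∀ o t n → o + 1 + t ≡ n → t ≡ n ∸ suc o
offset-rest o t n split = sym (begin
  n ∸ suc o          ≡⟨ cong (_∸ suc o) split ⟨
  o + 1 + t ∸ suc o  ≡⟨ cong (λ w → w + t ∸ suc o) (+-comm o 1) ⟩
  suc o + t ∸ suc o  ≡⟨ m+n∸m≡n (suc o) t ⟩
  t                  ∎)
  where open ≡-Reasoning

offset-< : ∀ o t n → o + 1 + t ≡ n → o < n
offset-< o t n split = ≤-trans (≤-reflexive (+-comm 1 o)) (≤-trans (m≤m+n (o + 1) t) (≤-reflexive split))

-- The arithmetic of one group when comparing occurrences with visited groups: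
-- the group holds r ≤ 2 occurrences, P occur before it and X after it, and
-- X = 0 if r = 2 and P ≥ 1.  The indicator 1 ⊓ P records "seen before".
group-step : ∀ r P X S → r ≤ 2 → (r ≡ 2 → 1 ≤ P → X ≡ 0) →
             X + 1 ⊓ (P + r) ≤ S + 2 → r + X + 1 ⊓ P ≤ 1 ⊓ r + S + 2
group-step 0 zero X S _ _ ih = ih
group-step 0 (suc P) X S _ _ ih = subst (λ w → X + 1 ⊓ w ≤ S + 2) (+-identityʳ (suc P)) ih
group-step 1 zero X S _ _ ih = s≤s (≤-trans (+-monoʳ-≤ X z≤n) ih)
group-step 1 (suc P) X S _ _ ih = s≤s ih
group-step 2 zero X S _ _ ih = s≤s (≤-trans (≤-reflexive (trans (cong suc (+-identityʳ X)) (+-comm 1 X))) ih)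
group-step 2 (suc P) X S _ none-after _ rewrite none-after refl (s≤s z≤n) = s≤s (m≤n+m 2 S)
group-step (suc (suc (suc r))) P X S (s≤s (s≤s ())) _ _

module Decomposition {q m b g : ℕ} {bs : Blocks} (A : IsADS 3 (q + 2) m bs) (m≤gb : m ≤ g * b) where

  s : List ℕ
  s = seq bs

  blocks≡m : length bs ≡ m
  blocks≡m = IsADS.numBlocks A

  E : ℕ → ℕ → ℕ → ℕ
  E x lo n = occ x (range bs lo n)

  E-+ : ∀ x lo n₁ n₂ → E x lo (n₁ + n₂) ≡ E x lo n₁ + E x (lo + n₁) n₂
  E-+ x lo n₁ n₂ = trans (cong (occ x) (range-+ bs lo n₁ n₂)) (occ-++ x (range bs lo n₁) _)

  E-snoc : ∀ x lo n → E x lo (suc n) ≡ E x lo n + E x (lo + n) 1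
  E-snoc x lo n = trans (cong (E x lo) (+-comm 1 n)) (E-+ x lo n 1)

  E-beyond : ∀ x lo n → m ≤ lo → E x lo n ≡ 0
  E-beyond x lo n m≤lo = cong (occ x) (range-beyond bs lo n (subst (_≤ lo) (sym blocks≡m) m≤lo))

  E-past-end : ∀ x lo n n′ → m ≤ lo + n → E x lo (n + n′) ≡ E x lo n
  E-past-end x lo n n′ le = trans (E-+ x lo n n′) (trans (cong (E x lo n +_) (E-beyond x (lo + n) n′ le)) (+-identityʳ _))

  E-total : ∀ x N → m ≤ N → E x 0 N ≡ occ x s
  E-total x N le = cong (occ x) (range-all bs N (subst (_≤ N) (sym blocks≡m) le))

  E-mono : ∀ x lo n n′ → E x lo n ≤ E x lo (n + n′)
  E-mono x lo n n′ = ≤-trans (m≤m+n _ _) (≤-reflexive (sym (E-+ x lo n n′)))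

  E-≤-to-end : ∀ x lo n → E x lo n ≤ E x lo m
  E-≤-to-end x lo n = ≤-trans (E-mono x lo n m) (≤-reflexive (trans (cong (E x lo) (+-comm n m)) (E-past-end x lo m n (m≤n+m m lo))))

  E>0⇒∈ : ∀ {x} lo n → 1 ≤ E x lo n → x ∈ range bs lo n
  E>0⇒∈ lo n = occ>0⇒∈ (range bs lo n)

  ∈⇒E>0 : ∀ {x} lo n → x ∈ range bs lo n → 1 ≤ E x lo n
  ∈⇒E>0 lo n = ∈⇒occ>0

  E-block≤1 : ∀ x p → E x p 1 ≤ 1
  E-block≤1 x p = occ-unique (block bs p ++ [])
    (subst Unique (sym (++-identityʳ (block bs p))) (block-unique bs p (IsADS.blocksDistinct A)))

  E-block-index : ∀ x p → 1 ≤ E x p 1 → p < m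
  E-block-index x p occurs with ∈-++⁻ (block bs p) (E>0⇒∈ p 1 occurs)
  ... | inj₁ x∈ = subst (p <_) blocks≡m (block-index bs p x∈)
  ... | inj₂ ()

  second-occurrence : ∀ x lo n → 2 ≤ E x lo n →
    Σ ℕ λ o → Σ ℕ λ t → o + 1 + t ≡ n × E x lo o ≡ 1 × E x (lo + o) 1 ≡ 1 × E x (lo + o + 1) t + 2 ≡ E x lo n
  second-occurrence x lo zero ()
  second-occurrence x lo (suc n) two with 2 ≤? E x lo n
  ... | yes two′ with second-occurrence x lo n two′
  ...   | o , t , o+1+t≡n , before , at , after = o , suc t , trans (+-suc (o + 1) t) (cong suc o+1+t≡n) , before , at , after′
    where
    open ≡-Reasoning
    after′ : E x (lo + o + 1) (suc t) + 2 ≡ E x lo (suc n)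
    after′ = begin
      E x (lo + o + 1) (suc t) + 2                     ≡⟨ cong (_+ 2) (E-snoc x (lo + o + 1) t) ⟩
      E x (lo + o + 1) t + E x (lo + o + 1 + t) 1 + 2  ≡⟨ cong (λ w → E x (lo + o + 1) t + E x w 1 + 2) (offset-+ lo o t n o+1+t≡n) ⟩
      E x (lo + o + 1) t + E x (lo + n) 1 + 2          ≡⟨ +-assoc (E x (lo + o + 1) t) _ 2 ⟩
      E x (lo + o + 1) t + (E x (lo + n) 1 + 2)        ≡⟨ cong (E x (lo + o + 1) t +_) (+-comm (E x (lo + n) 1) 2) ⟩
      E x (lo + o + 1) t + (2 + E x (lo + n) 1)        ≡⟨ +-assoc (E x (lo + o + 1) t) 2 _ ⟨
      E x (lo + o + 1) t + 2 + E x (lo + n) 1          ≡⟨ cong (_+ E x (lo + n) 1) after ⟩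
      E x lo n + E x (lo + n) 1                        ≡⟨ E-snoc x lo n ⟨
      E x lo (suc n)                                   ∎
  second-occurrence x lo (suc n) two | no ¬two′ = n , 0 , trans (+-identityʳ (n + 1)) (+-comm n 1) , before , at , sym total
    where
    split : E x lo (suc n) ≡ E x lo n + E x (lo + n) 1
    split = E-snoc x lo n
    one-before : E x lo n ≤ 1
    one-before = ≤-pred (≰⇒> ¬two′)
    at : E x (lo + n) 1 ≡ 1
    at = ≤-antisym (E-block≤1 x (lo + n))
           (+-cancelˡ-≤ 1 1 _ (≤-trans two (≤-trans (≤-reflexive split) (+-monoˡ-≤ _ one-before))))
    before : E x lo n ≡ 1
    before = ≤-antisym one-before
               (+-cancelʳ-≤ 1 1 _ (≤-trans two (≤-trans (≤-reflexive split) (+-monoʳ-≤ (E x lo n) (E-block≤1 x (lo + n))))))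
    total : E x lo (suc n) ≡ 2
    total = trans split (cong₂ _+_ before at)

  -- Group i consists of the blocks i·b, …, i·b + b − 1; only size i of them exist.
  group : ℕ → List ℕ
  group i = range bs (i * b) b

  size : ℕ → ℕ
  size i = b ⊓ (m ∸ i * b)

  E-size : ∀ x i → E x (i * b) (size i) ≡ E x (i * b) b
  E-size x i with b ≤? (m ∸ i * b)
  ... | yes b≤ = cong (E x (i * b)) (m≤n⇒m⊓n≡m b≤)
  ... | no b≰ = begin
    E x (i * b) (size i)                                  ≡⟨ cong (E x (i * b)) (m≥n⇒m⊓n≡n (<⇒≤ (≰⇒> b≰))) ⟩
    E x (i * b) (m ∸ i * b)                               ≡⟨ E-past-end x (i * b) (m ∸ i * b) (b ∸ (m ∸ i * b)) (m≤n+m∸n m (i * b)) ⟨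
    E x (i * b) ((m ∸ i * b) + (b ∸ (m ∸ i * b)))         ≡⟨ cong (E x (i * b)) (m+[n∸m]≡n (<⇒≤ (≰⇒> b≰))) ⟩
    E x (i * b) b                                         ∎
    where open ≡-Reasoning

  E-around : ∀ x i → occ x s ≡ E x 0 (i * b) + E x (i * b) b + E x (i * b + b) m
  E-around x i = begin
    occ x s                                                  ≡⟨ E-total x (i * b + (b + m)) (≤-trans (m≤n+m m b) (m≤n+m _ (i * b))) ⟨
    E x 0 (i * b + (b + m))                                  ≡⟨ E-+ x 0 (i * b) (b + m) ⟩
    E x 0 (i * b) + E x (i * b) (b + m)                      ≡⟨ cong (E x 0 (i * b) +_) (E-+ x (i * b) b m) ⟩
    E x 0 (i * b) + (E x (i * b) b + E x (i * b + b) m)      ≡⟨ +-assoc (E x 0 (i * b)) _ _ ⟨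
    E x 0 (i * b) + E x (i * b) b + E x (i * b + b) m        ∎
    where open ≡-Reasoning

  Local : ℕ → ℕ → Set
  Local i x = E x 0 (i * b) ≡ 0 × E x (i * b + b) m ≡ 0

  Local? : ∀ i x → Dec (Local i x)
  Local? i x = (E x 0 (i * b) ≟ 0) ×-dec (E x (i * b + b) m ≟ 0)

  restriction : ℕ → Blocks
  restriction i = tabulateFrom (λ p → filter (Local? i) (block bs p)) (i * b) (size i)

  restriction-seq : ∀ i → seq (restriction i) ≡ filter (Local? i) (range bs (i * b) (size i))
  restriction-seq i = concat-filter-blocks (Local? i) bs (i * b) (size i)

  occ-restriction : ∀ i x → Local i x → occ x s ≡ occ x (seq (restriction i))
  occ-restriction i x (none-before , none-after) = begin
    occ x s                                               ≡⟨ E-around x i ⟩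
    E x 0 (i * b) + E x (i * b) b + E x (i * b + b) m     ≡⟨ cong₂ (λ u v → u + E x (i * b) b + v) none-before none-after ⟩
    E x (i * b) b + 0                                     ≡⟨ +-identityʳ _ ⟩
    E x (i * b) b                                         ≡⟨ E-size x i ⟨
    E x (i * b) (size i)                                  ≡⟨ occ-filter (Local? i) (none-before , none-after) (range bs (i * b) (size i)) ⟨
    occ x (filter (Local? i) (range bs (i * b) (size i))) ≡⟨ cong (occ x) (restriction-seq i) ⟨
    occ x (seq (restriction i))                           ∎
    where open ≡-Reasoning

  -- The restriction is an ADS³_{q+2} sequence: it is a subsequence of s and keeps
  -- all occurrences of its symbols.
  restriction-ads : ∀ i → IsADS 3 (q + 2) (size i) (restriction i)
  restriction-ads i = record
    { numBlocks = length-tabulateFrom _ (i * b) (size i)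
    ; blocksDistinct = All-tabulateFrom _ (i * b) (size i) (λ p → filter⁺ (Local? i) (block-unique bs p (IsADS.blocksDistinct A)))
    ; enoughOcc = enough
    ; noAlt = λ a c a≢c sub → IsADS.noAlt A a c a≢c (⊆-trans sub restriction-⊆) }
    where
    restriction-⊆ : seq (restriction i) ⊆ s
    restriction-⊆ = subst (_⊆ s) (sym (restriction-seq i))
      (⊆-trans (filter-⊆ (Local? i) (range bs (i * b) (size i))) (range-⊆ bs (i * b) (size i)))
    enough : ∀ x → x ∈ seq (restriction i) → q + 2 ≤ occ x (seq (restriction i))
    enough x x∈ with ∈-filter⁻ (Local? i) {xs = range bs (i * b) (size i)} (subst (x ∈_) (restriction-seq i) x∈)
    ... | _ , local = subst (q + 2 ≤_) (occ-restriction i x local)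
      (IsADS.enoughOcc A x (occ>0⇒∈ s (subst (1 ≤_) (sym (occ-restriction i x local)) (∈⇒occ>0 x∈))))

  -- Frequent symbols: those visiting at least q groups. The contraction keeps
  -- one copy of each frequent symbol per group it visits, one block per group.
  visits-in : ℕ → ℕ → ℕ
  visits-in x i = occ x (deduplicate _≟_ (group i))

  visits : ℕ → ℕ
  visits x = sumFrom (visits-in x) 0 g

  Frequent : ℕ → Set
  Frequent x = q ≤ visits x

  Frequent? : ∀ x → Dec (Frequent x)
  Frequent? x = q ≤? visits x

  contracted-block : ℕ → List ℕ
  contracted-block i = deduplicate _≟_ (filter Frequent? (group i))

  contraction : Blocks
  contraction = tabulateFrom contracted-block 0 g

  groups-cover : concat (tabulateFrom group 0 g) ≡ s
  groups-cover = trans (concat-groups bs b 0 g) (range-all bs (g * b) (subst (_≤ g * b) (sym blocks≡m) m≤gb))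

  occ-contracted-block : ∀ x i → Frequent x → occ x (contracted-block i) ≡ visits-in x i
  occ-contracted-block x i frequent with x ∈? group i
  ... | yes x∈ = trans (occ-dedup _ (∈-filter⁺ Frequent? x∈ frequent)) (sym (occ-dedup _ x∈))
  ... | no x∉ = trans (occ-dedup-∉ _ (λ x∈ → x∉ (proj₁ (∈-filter⁻ Frequent? {xs = group i} x∈)))) (sym (occ-dedup-∉ _ x∉))

  -- The contraction is an ADS³_q(g) sequence: a subsequence of s whose symbols
  -- occur visits x ≥ q times.
  contraction-ads : IsADS 3 q g contraction
  contraction-ads = record
    { numBlocks = length-tabulateFrom contracted-block 0 g
    ; blocksDistinct = All-tabulateFrom contracted-block 0 g (λ i → deduplicate-! _)
    ; enoughOcc = enough
    ; noAlt = λ a c a≢c sub → IsADS.noAlt A a c a≢c (⊆-trans sub contraction-⊆) }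
    where
    contraction-⊆ : seq contraction ⊆ s
    contraction-⊆ = subst (seq contraction ⊆_) groups-cover
      (concat-tab-⊆ contracted-block group 0 g (λ k → ⊆-trans (deduplicate-⊆ _) (filter-⊆ Frequent? (group k))))
    enough : ∀ x → x ∈ seq contraction → q ≤ occ x (seq contraction)
    enough x x∈ with concat-tab-∈ contracted-block 0 g x∈
    ... | i , _ , _ , x∈i = subst (q ≤_) (sym occ≡visits) frequent
      where
      frequent : Frequent x
      frequent = proj₂ (∈-filter⁻ Frequent? {xs = group i} (∈-deduplicate⁻ _≟_ _ x∈i))
      occ≡visits : occ x (seq contraction) ≡ visits x
      occ≡visits = trans (occ-concat-tab x contracted-block 0 g) (sumFrom-cong _ _ 0 g (λ k → occ-contracted-block x k frequent))

  InFour : ℕ → ℕ → ℕ → ℕ → ℕ → ℕ → Set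
  InFour x lo n₁ n₂ n₃ n₄ =
    1 ≤ E x lo n₁ × 1 ≤ E x (lo + n₁) n₂ × 1 ≤ E x (lo + n₁ + n₂) n₃ × 1 ≤ E x (lo + n₁ + n₂ + n₃) n₄

  InFour? : ∀ x lo n₁ n₂ n₃ n₄ → Dec (InFour x lo n₁ n₂ n₃ n₄)
  InFour? x lo n₁ n₂ n₃ n₄ =
    (1 ≤? E x lo n₁) ×-dec (1 ≤? E x (lo + n₁) n₂) ×-dec
    (1 ≤? E x (lo + n₁ + n₂) n₃) ×-dec (1 ≤? E x (lo + n₁ + n₂ + n₃) n₄)

  four-ranges-⊆ : ∀ lo n₁ n₂ n₃ n₄ →
    range bs lo n₁ ++ range bs (lo + n₁) n₂ ++ range bs (lo + n₁ + n₂) n₃ ++ range bs (lo + n₁ + n₂ + n₃) n₄ ⊆ s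
  four-ranges-⊆ lo n₁ n₂ n₃ n₄ = subst (_⊆ s) split (range-⊆ bs lo (n₁ + (n₂ + (n₃ + n₄))))
    where
    split : range bs lo (n₁ + (n₂ + (n₃ + n₄))) ≡
            range bs lo n₁ ++ range bs (lo + n₁) n₂ ++ range bs (lo + n₁ + n₂) n₃ ++ range bs (lo + n₁ + n₂ + n₃) n₄
    split = trans (range-+ bs lo n₁ _) (cong (range bs lo n₁ ++_) (trans (range-+ bs (lo + n₁) n₂ _)
              (cong (range bs (lo + n₁) n₂ ++_) (range-+ bs (lo + n₁ + n₂) n₃ n₄))))

  -- Since the sequence has no alternation of length 5, at most one symbol
  -- occurs in all of four given consecutive ranges.
  InFour-unique : ∀ {x y} lo n₁ n₂ n₃ n₄ → InFour x lo n₁ n₂ n₃ n₄ → InFour y lo n₁ n₂ n₃ n₄ → x ≡ y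
  InFour-unique lo n₁ n₂ n₃ n₄ (x₁ , x₂ , x₃ , x₄) (y₁ , y₂ , y₃ , y₄) =
    four-segments (IsADS.noAlt A) _ _ _ _ (four-ranges-⊆ lo n₁ n₂ n₃ n₄)
      (E>0⇒∈ lo n₁ x₁ , E>0⇒∈ lo n₁ y₁) (E>0⇒∈ (lo + n₁) n₂ x₂ , E>0⇒∈ (lo + n₁) n₂ y₂)
      (E>0⇒∈ (lo + n₁ + n₂) n₃ x₃ , E>0⇒∈ (lo + n₁ + n₂) n₃ y₃)
      (E>0⇒∈ (lo + n₁ + n₂ + n₃) n₄ x₄ , E>0⇒∈ (lo + n₁ + n₂ + n₃) n₄ y₄)

  -- A kind of witness relates a symbol x to block i·b + o (offset o in group i).
  -- A before-witness: x occurs before group i, in group i before block i·b + o,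
  -- at it, and after it. An after-witness: x occurs in group i before, at and
  -- after block i·b + o, and after group i.
  Witness : Set₁
  Witness = ℕ → ℕ → ℕ → Set

  Before : Witness
  Before x i o = InFour x 0 (i * b) o 1 m

  After : Witness
  After x i o = InFour x (i * b) o 1 (b ∸ suc o) m

  HasWitness : Witness → ℕ → Set
  HasWitness K x = ∃ λ i → i < g × ∃ λ o → o < b × K x i o

  HasWitness? : (K : Witness) → (∀ x i o → Dec (K x i o)) → ∀ x → Dec (HasWitness K x)
  HasWitness? K K? x = anyUpTo? (λ i → anyUpTo? (λ o → K? x i o) b) g

  -- The block index of a chosen witness (0 when there is none).
  position : (K : Witness) → (∀ x i o → Dec (K x i o)) → ℕ → ℕ
  position K K? x with HasWitness? K K? x
  ... | yes (i , _ , o , _ , _) = i * b + o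
  ... | no _ = 0

  position-spec : ∀ K K? x → HasWitness K x → Σ ℕ λ i → Σ ℕ λ o → o < b × K x i o × position K K? x ≡ i * b + o
  position-spec K K? x w with HasWitness? K K? x
  ... | yes (i , _ , o , o<b , k) = i , o , o<b , k , refl
  ... | no ¬w = contradiction w ¬w

  witnessed≤m : ∀ (K : Witness) (K? : ∀ x i o → Dec (K x i o)) →
                (∀ {x y} i o → K x i o → K y i o → x ≡ y) → (∀ {x} i o → K x i o → i * b + o < m) →
                ∀ xs → Unique xs → length (filter (HasWitness? K K?) xs) ≤ m
  witnessed≤m K K? unique-at inside xs u = begin
    length W                       ≤⟨ pigeonhole (position K K?) W (upTo m) (filter⁺ (HasWitness? K K?) u) injective into ⟩
    length (upTo m)                ≡⟨ length-upTo m ⟩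
    m                              ∎
    where
    open ≤-Reasoning
    W = filter (HasWitness? K K?) xs
    spec : ∀ {a} → a ∈ W → Σ ℕ λ i → Σ ℕ λ o → o < b × K a i o × position K K? a ≡ i * b + o
    spec {a} a∈ = position-spec K K? a (proj₂ (∈-filter⁻ (HasWitness? K K?) {xs = xs} a∈))
    injective : ∀ {a c} → a ∈ W → c ∈ W → position K K? a ≡ position K K? c → a ≡ c
    injective a∈ c∈ same with spec a∈ | spec c∈
    ... | i , o , o<b , ka , pa | i′ , o′ , o′<b , kc , pc
      with position-injective b i i′ o o′ o<b o′<b (trans (sym pa) (trans same pc))
    ...   | refl , refl = unique-at i o ka kc
    into : ∀ {a} → a ∈ W → position K K? a ∈ upTo m
    into a∈ with spec a∈
    ... | i , o , _ , ka , pa = ∈-upTo⁺ (subst (_< m) (sym pa) (inside i o ka))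

  Before? : ∀ x i o → Dec (Before x i o)
  Before? x i o = InFour? x 0 (i * b) o 1 m

  After? : ∀ x i o → Dec (After x i o)
  After? x i o = InFour? x (i * b) o 1 (b ∸ suc o) m

  -- the witness position i·b + o determines x (InFour-unique) and is a block index < m.
  before-witnessed≤m : ∀ xs → Unique xs → length (filter (HasWitness? Before Before?) xs) ≤ m
  before-witnessed≤m = witnessed≤m Before Before? (λ i o → InFour-unique 0 (i * b) o 1 m)
    (λ {x} i o (_ , _ , at , _) → E-block-index x (i * b + o) at)

  after-witnessed≤m : ∀ xs → Unique xs → length (filter (HasWitness? After After?) xs) ≤ m
  after-witnessed≤m = witnessed≤m After After? (λ i o → InFour-unique (i * b) o 1 (b ∸ suc o) m)
    (λ {x} i o (_ , at , _) → E-block-index x (i * b + o) at)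

  -- A symbol that is local to no group and has no witness occurs at most twice in every group:
  -- its second and third occurrences in a group would give a witness or make it local.
  at-most-two : ∀ x → (∀ i → i < g → ¬ Local i x) → ¬ HasWitness Before x → ¬ HasWitness After x →
                ∀ k → k < g → E x (k * b) b ≤ 2
  at-most-two x nonlocal no-before no-after k k<g with 3 ≤? E x (k * b) b
  ... | no ¬three = ≤-pred (≰⇒> ¬three)
  ... | yes three with second-occurrence x (k * b) b (≤-trans (n≤1+n 2) three)
  ...   | o , t , split , one , second , rest = ⊥-elim (by-earlier (E x 0 (k * b) ≟ 0))
    where
    third : 1 ≤ E x (k * b + o + 1) t
    third = +-cancelʳ-≤ 2 1 _ (≤-trans three (≤-reflexive (sym rest)))
    by-earlier : Dec (E x 0 (k * b) ≡ 0) → ⊥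
    by-earlier (no earlier) = no-before (k , k<g , o , offset-< o t b split ,
      n≢0⇒n>0 earlier , ≤-reflexive (sym one) , ≤-reflexive (sym second) , ≤-trans third (E-≤-to-end x _ t))
    by-earlier (yes none-earlier) with E x (k * b + b) m ≟ 0
    ... | yes none-later = nonlocal k k<g (none-earlier , none-later)
    ... | no later = no-after (k , k<g , o , offset-< o t b split ,
      subst (λ t → InFour x (k * b) o 1 t m) (offset-rest o t b split)
        (≤-reflexive (sym one) , ≤-reflexive (sym second) , third ,
         subst (λ w → 1 ≤ E x w m) (sym (offset-+ (k * b) o t b split)) (n≢0⇒n>0 later)))

  two-then-none-after : ∀ x → ¬ HasWitness Before x → ∀ k → k < g →
                        E x (k * b) b ≡ 2 → 1 ≤ E x 0 (k * b) → E x (k * b + b) m ≡ 0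
  two-then-none-after x no-before k k<g two earlier with E x (k * b + b) m ≟ 0
  ... | yes none-later = none-later
  ... | no later with second-occurrence x (k * b) b (≤-reflexive (sym two))
  ...   | o , t , split , one , second , _ =
    contradiction (k , k<g , o , offset-< o t b split , earlier , ≤-reflexive (sym one) , ≤-reflexive (sym second) , after-second)
                  no-before
    where
    open ≤-Reasoning
    lo = k * b + o + 1
    after-second : 1 ≤ E x lo m
    after-second = begin
      1                      ≤⟨ n≢0⇒n>0 later ⟩
      E x (k * b + b) m      ≡⟨ cong (λ w → E x w m) (offset-+ (k * b) o t b split) ⟨
      E x (lo + t) m         ≤⟨ m≤n+m _ (E x lo t) ⟩
      E x lo t + E x (lo + t) m  ≡⟨ E-+ x lo t m ⟨
      E x lo (t + m)         ≤⟨ E-≤-to-end x lo (t + m) ⟩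
      E x lo m               ∎

  visits-in-≡ : ∀ x i → visits-in x i ≡ 1 ⊓ E x (i * b) b
  visits-in-≡ x i with E x (i * b) b in r
  ... | zero = occ-dedup-∉ (group i) (λ x∈ → contradiction (subst (1 ≤_) r (∈⇒E>0 (i * b) b x∈)) λ ())
  ... | suc _ = occ-dedup (group i) (E>0⇒∈ (i * b) b (subst (1 ≤_) (sym r) (s≤s z≤n)))

  -- Counting group by group from group i on (i + n = g): occurrences plus the
  -- indicator "x occurred before group i" exceed the visited groups by at most 2.
  suffix-bound : ∀ x → (∀ k → k < g → E x (k * b) b ≤ 2) →
    (∀ k → k < g → E x (k * b) b ≡ 2 → 1 ≤ E x 0 (k * b) → E x (k * b + b) m ≡ 0) →
    ∀ n i → i + n ≡ g → E x (i * b) (n * b) + 1 ⊓ E x 0 (i * b) ≤ sumFrom (visits-in x) i n + 2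
  suffix-bound x ≤two two-last zero i _ = ≤-trans (m⊓n≤m 1 (E x 0 (i * b))) (s≤s z≤n)
  suffix-bound x ≤two two-last (suc n) i i+n≡g = begin
    E x (i * b) (b + n * b) + 1 ⊓ P          ≡⟨ cong (_+ 1 ⊓ P) (E-+ x (i * b) b (n * b)) ⟩
    r + E x (i * b + b) (n * b) + 1 ⊓ P      ≡⟨ cong (λ w → r + E x w (n * b) + 1 ⊓ P) (+-comm (i * b) b) ⟩
    r + X + 1 ⊓ P                            ≤⟨ group-step r P X S (≤two i i<g) none-after ih ⟩
    1 ⊓ r + S + 2                            ≡⟨ cong (λ v → v + S + 2) (visits-in-≡ x i) ⟨
    sumFrom (visits-in x) i (suc n) + 2      ∎
    where
    open ≤-Reasoning
    i<g : i < g
    i<g = subst (i <_) i+n≡g (m<m+n i (s≤s z≤n))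
    P = E x 0 (i * b)
    r = E x (i * b) b
    X = E x (suc i * b) (n * b)
    S = sumFrom (visits-in x) (suc i) n
    ih : X + 1 ⊓ (P + r) ≤ S + 2
    ih = subst (λ w → X + 1 ⊓ w ≤ S + 2) (trans (cong (E x 0) (+-comm b (i * b))) (E-+ x 0 (i * b) b))
           (suffix-bound x ≤two two-last n (suc i) (trans (sym (+-suc i n)) i+n≡g))
    none-after : r ≡ 2 → 1 ≤ P → X ≡ 0
    none-after two earlier = n≤0⇒n≡0 (begin
      X                     ≡⟨ cong (λ w → E x w (n * b)) (+-comm b (i * b)) ⟩
      E x (i * b + b) (n * b) ≤⟨ E-≤-to-end x _ (n * b) ⟩
      E x (i * b + b) m     ≡⟨ two-last i i<g two earlier ⟩
      0                     ∎)

  -- Otherwise it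
  -- occurs at most twice per group, and suffix-bound gives q + 2 ≤ occ x s ≤ visits x + 2,
  -- so it would be frequent after all.
  classify : ∀ x → x ∈ s →
    (∃ λ i → i < g × Local i x) ⊎ Frequent x ⊎ HasWitness Before x ⊎ HasWitness After x
  classify x x∈ with anyUpTo? (λ i → Local? i x) g
  ... | yes local = inj₁ local
  ... | no ¬local with Frequent? x
  ...   | yes frequent = inj₂ (inj₁ frequent)
  ...   | no ¬frequent with HasWitness? Before Before? x
  ...     | yes before = inj₂ (inj₂ (inj₁ before))
  ...     | no ¬before with HasWitness? After After? x
  ...       | yes after = inj₂ (inj₂ (inj₂ after))
  ...       | no ¬after = contradiction frequent ¬frequent
    where
    open ≤-Reasoning
    nonlocal : ∀ i → i < g → ¬ Local i x
    nonlocal i i<g local = ¬local (i , i<g , local)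
    frequent : Frequent x
    frequent = +-cancelʳ-≤ 2 q (visits x) (begin
      q + 2                               ≤⟨ IsADS.enoughOcc A x x∈ ⟩
      occ x s                             ≡⟨ E-total x (g * b) m≤gb ⟨
      E x 0 (g * b)                       ≡⟨ +-identityʳ _ ⟨
      E x 0 (g * b) + 0                   ≤⟨ suffix-bound x (at-most-two x nonlocal ¬before ¬after)
                                               (two-then-none-after x ¬before) g 0 refl ⟩
      visits x + 2                        ∎)

  distinct-decomposition : distinct s ≤ sumFrom (λ i → distinct (seq (restriction i))) 0 g + distinct (seq contraction) + m + m
  distinct-decomposition = begin
    length U                                              ≤⟨ pigeonhole (λ x → x) U (L ++ C ++ WB ++ WA) (deduplicate-! s) (λ _ _ eq → eq) cover ⟩
    length (L ++ C ++ WB ++ WA)                           ≡⟨ lengths ⟩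
    length L + (length C + (length WB + length WA))       ≤⟨ +-monoʳ-≤ (length L) (+-monoʳ-≤ (length C)
                                                               (+-mono-≤ (before-witnessed≤m U (deduplicate-! s)) (after-witnessed≤m U (deduplicate-! s)))) ⟩
    length L + (length C + (m + m))                       ≡⟨ cong (_+ (length C + (m + m))) (length-concat-tab _ 0 g) ⟩
    Σloc + (length C + (m + m))                           ≡⟨ reassociate Σloc (length C) m ⟩
    Σloc + distinct (seq contraction) + m + m             ∎
    where
    open ≤-Reasoning
    U = deduplicate _≟_ s
    L = concat (tabulateFrom (λ i → deduplicate _≟_ (seq (restriction i))) 0 g)
    C = deduplicate _≟_ (seq contraction)
    WB = filter (HasWitness? Before Before?) U
    WA = filter (HasWitness? After After?) U
    Σloc = sumFrom (λ i → distinct (seq (restriction i))) 0 g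
    lengths : length (L ++ C ++ WB ++ WA) ≡ length L + (length C + (length WB + length WA))
    lengths = trans (length-++ L) (cong (length L +_) (trans (length-++ C) (cong (length C +_) (length-++ WB))))
    reassociate : ∀ a c d → a + (c + (d + d)) ≡ a + c + d + d
    reassociate a c d = trans (sym (+-assoc a c (d + d))) (sym (+-assoc (a + c) d d))
    cover : ∀ {z} → z ∈ U → z ∈ L ++ C ++ WB ++ WA
    cover {z} z∈U with classify z (∈-deduplicate⁻ _≟_ s z∈U)
    ... | inj₁ (i , i<g , local) = ∈-++⁺ˡ (∈-concat-tab _ 0 g i z≤n i<g (∈-deduplicate⁺ _≟_ z∈restriction))
      where
      z∈restriction : z ∈ seq (restriction i)
      z∈restriction = occ>0⇒∈ _ (subst (1 ≤_) (occ-restriction i z local) (∈⇒occ>0 (∈-deduplicate⁻ _≟_ s z∈U)))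
    ... | inj₂ (inj₁ frequent) = ∈-++⁺ʳ L (∈-++⁺ˡ (∈-deduplicate⁺ _≟_ z∈contraction))
      where
      z∈contraction : z ∈ seq contraction
      z∈contraction with concat-tab-∈ group 0 g (subst (z ∈_) (sym groups-cover) (∈-deduplicate⁻ _≟_ s z∈U))
      ... | i , _ , i<g , z∈i = ∈-concat-tab contracted-block 0 g i z≤n i<g (∈-deduplicate⁺ _≟_ (∈-filter⁺ Frequent? z∈i frequent))
    ... | inj₂ (inj₂ (inj₁ before)) = ∈-++⁺ʳ L (∈-++⁺ʳ C (∈-++⁺ˡ (∈-filter⁺ (HasWitness? Before Before?) z∈U before)))
    ... | inj₂ (inj₂ (inj₂ after)) = ∈-++⁺ʳ L (∈-++⁺ʳ C (∈-++⁺ʳ WB (∈-filter⁺ (HasWitness? After After?) z∈U after)))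

decomposition : ∀ {q b g m} → m ≤ g * b → (Av Q : ℕ) →
                (∀ {m′} → m′ ≤ b → N³≤ (q + 2) m′ (m′ * Av)) → N³≤ q g Q →
                N³≤ (q + 2) m (m * Av + Q + m + m)
decomposition {q} {b} {g} {m} m≤gb Av Q groups-bound contraction-bound bs A = begin
  distinct (seq bs)                                                      ≤⟨ distinct-decomposition ⟩
  sumFrom (λ i → distinct (seq (restriction i))) 0 g + distinct (seq contraction) + m + m
    ≤⟨ +-monoˡ-≤ m (+-monoˡ-≤ m (+-mono-≤ local-part (contraction-bound contraction contraction-ads))) ⟩
  m * Av + Q + m + m                                                     ∎
  where
  open ≤-Reasoning
  open Decomposition {b = b} {g = g} A m≤gb
  local-part : sumFrom (λ i → distinct (seq (restriction i))) 0 g ≤ m * Av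
  local-part = begin
    sumFrom (λ i → distinct (seq (restriction i))) 0 g  ≤⟨ sumFrom-mono _ _ 0 g (λ i → groups-bound (m⊓n≤m b _) (restriction i) (restriction-ads i)) ⟩
    sumFrom (λ i → size i * Av) 0 g                     ≡⟨ sumFrom-*ʳ size Av 0 g ⟩
    sumFrom size 0 g * Av                               ≡⟨ cong (_* Av) (trans (group-sizes b g m) (m≤n⇒m⊓n≡m m≤gb)) ⟩
    m * Av                                              ∎

group-count : ∀ m b → 1 ≤ b → Σ ℕ λ g → m ≤ g * b × g * b < m + b
group-count zero b 1≤b = 0 , z≤n , 1≤b
group-count (suc m) b 1≤b with group-count m b 1≤b
... | g , m≤gb , gb< with suc m ≤? g * b
...   | yes fits = g , fits , m<n⇒m<1+n gb<
...   | no ¬fits = suc g , covers , s≤s (≤-reflexive (trans (cong (b +_) gb≡m) (+-comm b m)))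
  where
  open ≤-Reasoning
  gb≡m : g * b ≡ m
  gb≡m = ≤-antisym (≤-pred (≰⇒> ¬fits)) m≤gb
  covers : suc m ≤ suc g * b
  covers = begin
    suc m       ≡⟨ cong suc gb≡m ⟨
    1 + g * b   ≤⟨ +-monoˡ-≤ (g * b) 1≤b ⟩
    b + g * b   ∎

-- Split the blocks into
-- two halves of ⌈m/2⌉ blocks; the contraction has 2 blocks but would need 3
-- occurrences per symbol, so it is empty, and α_2(m) = 1 + α_2(⌈m/2⌉).
N³₅-bound : ∀ m → N³≤ 5 m (2 * m * α 2 m)
N³₅-bound = <-rec _ step
  where
  step : ∀ m → (∀ {m′} → m′ < m → N³≤ 5 m′ (2 * m′ * α 2 m′)) → N³≤ 5 m (2 * m * α 2 m)
  step zero _ _ A = few-blocks A (s≤s z≤n)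
  step (suc zero) _ _ A = few-blocks A (s≤s (s≤s z≤n))
  step (suc (suc y)) rec =
    subst (N³≤ 5 M) (trans (total M (α 2 h)) (cong (2 * M *_) (sym (α-unfold 0 y))))
      (decomposition {q = 3} {b = h} {g = 2} M≤2h (2 * α 2 h) 0 halves empty)
    where
    M = 2 + y
    h = ⌈ M /2⌉
    M≤2h : M ≤ 2 * h
    M≤2h = begin
      M                ≡⟨ ⌊n/2⌋+⌈n/2⌉≡n M ⟨
      ⌊ M /2⌋ + h      ≤⟨ +-monoˡ-≤ h (⌊n/2⌋≤⌈n/2⌉ M) ⟩
      h + h            ≡⟨ cong (h +_) (+-identityʳ h) ⟨
      2 * h            ∎
      where open ≤-Reasoning
    halves : ∀ {m′} → m′ ≤ h → N³≤ 5 m′ (m′ * (2 * α 2 h))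
    halves {m′} m′≤h bs A = ≤-trans (rec (≤-<-trans m′≤h (shrinks (α-shrinking 0) y)) bs A)
      (≤-trans (*-monoʳ-≤ (2 * m′) (α-mono 1 m′≤h)) (≤-reflexive (swap m′ (α 2 h))))
      where
      swap : ∀ a c → 2 * a * c ≡ a * (2 * c)
      swap = solve-∀
    empty : N³≤ 3 2 0
    empty bs A = few-blocks A (s≤s (s≤s (s≤s z≤n)))
    total : ∀ m a → m * (2 * a) + 0 + m + m ≡ 2 * m * (1 + a)
    total = solve-∀

-- Sequences of at most 1400 blocks (at least 5 occurrences per symbol) have at most
-- 22 symbols per block, since α_2(1400) = 11.
short-sequences : ∀ {q m} → 5 ≤ q → m ≤ 1400 → N³≤ q m (m * 22)
short-sequences {m = m} 5≤q m≤1400 bs A = begin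
  distinct (seq bs)   ≤⟨ N³₅-bound m bs (weaken 5≤q A) ⟩
  2 * m * α 2 m       ≤⟨ *-monoʳ-≤ (2 * m) (α-mono 1 m≤1400) ⟩
  2 * m * α 2 1400    ≡⟨ cong (2 * m *_) α₂-1400 ⟩
  2 * m * 11          ≡⟨ double m ⟩
  m * 22              ∎
  where
  open ≤-Reasoning
  double : ∀ m → 2 * m * 11 ≡ m * 22
  double = solve-∀

Level : ℕ → Set
Level k = ∀ m → N³≤ (2 * k + 1) m (32 * m * α k m)

level-2 : Level 2
level-2 m bs A = ≤-trans (N³₅-bound m bs A) (*-monoˡ-≤ (α 2 m) (*-monoˡ-≤ m (m≤m+n 2 30)))

-- Contraction bound at level K = k + 2 for groups of b = 8·α_K(m) blocks: since there
-- are g < m/b + 1 groups, level K bounds the contraction by 32g·α_K(g) ≤ 4gb < 8m.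
contraction-bound : ∀ {k m g} → Level (2 + k) → 1 ≤ α (2 + k) m →
                    g * (8 * α (2 + k) m) < m + 8 * α (2 + k) m → N³≤ (2 * (2 + k) + 1) g (8 * m)
contraction-bound {g = zero} _ _ _ bs A = few-blocks A (s≤s z≤n)
contraction-bound {g = suc zero} _ _ _ bs A = few-blocks A (s≤s (s≤s z≤n))
contraction-bound {k} {m} {suc (suc g₀)} level T≥1 Gb< bs A = begin
  distinct (seq bs)       ≤⟨ level G bs A ⟩
  32 * G * α (2 + k) G    ≤⟨ *-monoʳ-≤ (32 * G) (α-mono (suc k) G≤m) ⟩
  32 * G * T              ≡⟨ regroup G T ⟩
  4 * (G * b)             ≤⟨ *-monoʳ-≤ 4 (<⇒≤ Gb<2m) ⟩
  4 * (m + m)             ≡⟨ double m ⟩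
  8 * m                   ∎
  where
  open ≤-Reasoning
  G = 2 + g₀
  T = α (2 + k) m
  b = 8 * T
  regroup : ∀ g t → 32 * g * t ≡ 4 * (g * (8 * t))
  regroup = solve-∀
  double : ∀ m → 4 * (m + m) ≡ 8 * m
  double = solve-∀
  b<m : b < m
  b<m = +-cancelʳ-≤ b (suc b) m (≤-trans (s≤s (+-monoʳ-≤ b (m≤m+n b (g₀ * b)))) Gb<)
  Gb<2m : G * b < m + m
  Gb<2m = ≤-trans Gb< (+-monoʳ-≤ m (<⇒≤ b<m))
  G≤m : G ≤ m
  G≤m = begin
    G                   ≤⟨ s≤s (m≤m*n (suc g₀) b {{>-nonZero (≤-trans T≥1 (m≤m+n T _))}}) ⟩
    suc (suc g₀ * b)    ≤⟨ +-cancelʳ-≤ b _ m (≤-trans (≤-reflexive (cong suc (+-comm (suc g₀ * b) b))) Gb<) ⟩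
    m                   ∎

occurrences-step : ∀ k → 2 * suc k + 1 ≡ (2 * k + 1) + 2
occurrences-step = solve-∀

level-decomposition : ∀ {k} → Level (2 + k) → ∀ y Av →
  (∀ {m′} → m′ ≤ 8 * α (2 + k) (2 + y) → N³≤ (2 * (3 + k) + 1) m′ (m′ * Av)) →
  N³≤ (2 * (3 + k) + 1) (2 + y) ((2 + y) * Av + 8 * (2 + y) + (2 + y) + (2 + y))
level-decomposition {k} level y Av groups =
  subst (λ q → N³≤ q M (M * Av + 8 * M + M + M)) (sym (occurrences-step (2 + k)))
    (decomposition {q = 2 * (2 + k) + 1} {b = b} {g = g} M≤gb Av (8 * M) groups′ (contraction-bound level T≥1 gb<))
  where
  M = 2 + y
  T = α (2 + k) M
  b = 8 * T
  T≥1 : 1 ≤ T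
  T≥1 = α-pos (suc k) y
  count = group-count M b (≤-trans T≥1 (m≤m+n T _))
  g = proj₁ count
  M≤gb = proj₁ (proj₂ count)
  gb< = proj₂ (proj₂ count)
  groups′ : ∀ {m′} → m′ ≤ b → N³≤ ((2 * (2 + k) + 1) + 2) m′ (m′ * Av)
  groups′ {m′} m′≤b = subst (λ q → N³≤ q m′ (m′ * Av)) (occurrences-step (2 + k)) (groups m′≤b)

-- Induction step: level k + 2 implies level k + 3, by strong induction on m ≥ 2.
-- With T = α_{k+2}(m) and a = α_{k+3}(T), so that α_{k+3}(m) = 1 + a, decompose
-- with groups of 8T blocks. If T < 176 the groups are short (22 symbols per block),
-- giving 32m in total. Otherwise decompose each group once more, with groups of
-- at most 8·α_{k+2}(m′) ≤ T blocks, which have ≤ 32a symbols per block by induction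
-- on m; so the groups have ≤ 32a + 10 per block and the whole ≤ 32m(1 + a).
level-step : ∀ {k} → Level (2 + k) → Level (3 + k)
level-step {k} level = <-rec _ step
  where
  q = 2 * (3 + k) + 1
  five≤q : 5 ≤ q
  five≤q = ≤-trans (m≤m+n 5 (2 + 2 * k)) (≤-reflexive (expand k))
    where
    expand : ∀ k → 5 + (2 + 2 * k) ≡ 2 * (3 + k) + 1
    expand = solve-∀
  step : ∀ M → (∀ {m} → m < M → N³≤ q m (32 * m * α (3 + k) m)) → N³≤ q M (32 * M * α (3 + k) M)
  step zero _ bs A = few-blocks A (s≤s z≤n)
  step (suc zero) _ bs A = few-blocks A (s≤s (s≤s z≤n))
  step (suc (suc y)) rec with 176 ≤? α (2 + k) (2 + y)
  ... | no small = N³≤-mono total (level-decomposition level y 22 short)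
    where
    M = 2 + y
    short : ∀ {m′} → m′ ≤ 8 * α (2 + k) M → N³≤ q m′ (m′ * 22)
    short m′≤b = short-sequences five≤q (≤-trans m′≤b (*-monoʳ-≤ 8 (≤-pred (≰⇒> small))))
    total : M * 22 + 8 * M + M + M ≤ 32 * M * α (3 + k) M
    total = begin
      M * 22 + 8 * M + M + M   ≡⟨ collect M ⟩
      32 * M * 1               ≤⟨ *-monoʳ-≤ (32 * M) (α-pos (2 + k) y) ⟩
      32 * M * α (3 + k) M     ∎
      where
      open ≤-Reasoning
      collect : ∀ m → m * 22 + 8 * m + m + m ≡ 32 * m * 1
      collect = solve-∀
  ... | yes large = N³≤-mono total (level-decomposition level y (32 * a + 10) groups)
    where
    M = 2 + y
    T = α (2 + k) M
    a = α (3 + k) T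
    -- Inner groups have at most T < M blocks, so the induction on m applies.
    inner : ∀ {m′} → m′ ≤ 8 * T → ∀ {m″} → m″ ≤ 8 * α (2 + k) m′ → N³≤ q m″ (m″ * (32 * a))
    inner {m′} m′≤8T {m″} m″≤b′ =
      N³≤-mono (≤-trans (*-monoʳ-≤ (32 * m″) (α-mono (2 + k) m″≤T)) (≤-reflexive (swap m″ a)))
               (rec (≤-<-trans m″≤T (shrinks (α-shrinking (suc k)) y)))
      where
      m″≤T : m″ ≤ T
      m″≤T = ≤-trans m″≤b′ (≤-trans (*-monoʳ-≤ 8 (≤-trans (α≤α₂ k m′) (α-mono 1 m′≤8T))) (α₂-key T large))
      swap : ∀ m a → 32 * m * a ≡ m * (32 * a)
      swap = solve-∀
    groups : ∀ {m′} → m′ ≤ 8 * T → N³≤ q m′ (m′ * (32 * a + 10))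
    groups {zero} _ bs A = few-blocks A (s≤s z≤n)
    groups {suc zero} _ bs A = few-blocks A (s≤s (s≤s z≤n))
    groups {suc (suc y′)} m′≤8T =
      N³≤-mono (≤-reflexive (per-block (2 + y′) a)) (level-decomposition level y′ (32 * a) (inner m′≤8T))
      where
      per-block : ∀ m a → m * (32 * a) + 8 * m + m + m ≡ m * (32 * a + 10)
      per-block = solve-∀
    total : M * (32 * a + 10) + 8 * M + M + M ≤ 32 * M * α (3 + k) M
    total = begin
      M * (32 * a + 10) + 8 * M + M + M   ≡⟨ collect M a ⟩
      32 * M * a + 20 * M                 ≤⟨ +-monoʳ-≤ (32 * M * a) (*-monoˡ-≤ M (m≤m+n 20 12)) ⟩
      32 * M * a + 32 * M                 ≡⟨ factor M a ⟩
      32 * M * (1 + a)                    ≡⟨ cong (32 * M *_) (α-unfold (suc k) y) ⟨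
      32 * M * α (3 + k) M                ∎
      where
      open ≤-Reasoning
      collect : ∀ m a → m * (32 * a + 10) + 8 * m + m + m ≡ 32 * m * a + 20 * m
      collect = solve-∀
      factor : ∀ m a → 32 * m * a + 32 * m ≡ 32 * m * (1 + a)
      factor = solve-∀

level : ∀ k → Level (2 + k)
level zero = level-2
level (suc k) = level-step (level k)

corollary4p8 : ∃[ c ] (∀ (k : ℕ) → 2 ≤ k → ∀ (m : ℕ) (bs : Blocks) →
                 IsADS 3 (2 * k + 1) m bs →
                 distinct (seq bs) ≤ c * m * α k m)
corollary4p8 = 32 , all-levels
  where
  all-levels : ∀ k → 2 ≤ k → Level k
  all-levels (suc (suc k)) _ = level k
  all-levels zero ()
  all-levels (suc zero) (s≤s ())
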